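{- Let $\Delta$ be a field discriminant, $\mathbb K=\mathbb Q(\sqrt\Delta)$ with class number $h_{\mathbb K}$ and integral basis $\{1,\omega\}$, and let $Q_0(x,y)=x^2+(\omega+\bar\omega)xy+\omega\bar\omega y^2$ be the principal form. Let $Q_i(x,y)$ be a reduced form of discriminant $\Delta$, associated to the ideal $\mathfrak I_{a_i}=\langle a_i,\beta_i+\omega\rangle$ of norm $a_i$, so that $Q_i(x,y)=N_{\mathbb K}(a_ix+(\beta_i+\omega)y)/a_i$. Suppose the odd prime $p$ is represented by $Q_i$. Then the ideal $p\mathcal O_{\mathbb K}$ splits as $\mathfrak P\bar{\mathfrak P}$ into two (principal or non-principal) ideals; let $\ell_p$ be the minimum divisor of $h_{\mathbb K}$ such that $\mathfrak P^{\ell_p}$ is principal. Let $\pi_{a_i}\in\mathcal O_{\mathbb K}$ be a generator of the principal ideal $\mathfrak I_{a_i}^{\ell_p}$ (of norm $a_i^{\ell_p}$) and define homogeneous polynomials $a_1(x,y),a_2(x,y)$ of degree $\ell_p$ by $$a_1(x,y)+\omega\, a_2(x,y)=\frac{\bar\pi_{a_i}\,[a_ix+(\beta_i+\omega)y]^{\ell_p}}{a_i^{\ell_p}}.$$ Then integers $x_0,y_0$ with $Q_i(x_0,y_0)=p$ can be obtained as a solution of the Diophantine system $$a_1(x,y)=u,\qquad a_2(x,y)=v,$$ where $u,v$ are integers with $p^{\ell_p}=Q_0(u,v)$, the sign of $u$ being selected appropriately.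
   Context: Throughout, a discriminant $\Delta$ is assumed either square-free or $4$ times a square-free integer; $D=\Delta$ if $\Delta\equiv1\pmod 4$ and $D=\Delta/4$ if $\Delta\equiv 0\pmod 4$; $\omega=\frac{1+\sqrt D}{2}$ if $D\equiv1\pmod4$ and $\omega=\sqrt D$ if $D\equiv 2,3\pmod 4$; bar denotes Galois conjugation in $\mathbb K$, and $N_{\mathbb K}$ the field norm (the norm of an ideal being the index of the ideal in $\mathcal O_{\mathbb K}$). $\langle a,b\rangle$ denotes the $\mathcal O_{\mathbb K}$-ideal generated by $a,b$. A form $(a,b,c)$ is reduced if $|b|\le a\le c$ when $\Delta<0$, and $0<b<\sqrt\Delta$, $\sqrt\Delta-b<2|a|<\sqrt\Delta+b$ when $\Delta>0$. -}

module Defs where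

open import Data.Bool using (Bool; true; false; if_then_else_)
open import Data.Nat as ℕ using (ℕ; _≡ᵇ_)
import Data.Nat.Divisibility as ℕD
open import Data.Integer
open import Data.Integer.DivMod using (_%ℕ_; _/ℕ_)
open import Data.Integer.Divisibility using () renaming (_∣_ to _∣ℤ_)
open import Data.Fin using (Fin)
open import Data.List using (List; foldr)
open import Data.List.Relation.Unary.All using (All)
open import Data.Product using (Σ; ∃; ∃-syntax; _×_; _,_)
open import Data.Sum using (_⊎_)
open import Relation.Nullary using (¬_)
open import Relation.Binary.PropositionalEquality using (_≡_; _≢_)

SquareFree : ℤ → Set
SquareFree D = ∀ (k : ℤ) → (k * k) ∣ℤ D → ∣ k ∣ ≡ 1

isOne4 : ℤ → Bool
isOne4 D = (D %ℕ 4) ≡ᵇ 1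

Disc : ℤ → ℤ
Disc D = if isOne4 D then D else (+ 4) * D

-- ω = (1+√D)/2 or √D satisfies ω² = tr·ω − nm, where
-- tr = ω + ω̄ and nm = ω ω̄.
tr : ℤ → ℤ
tr D = if isOne4 D then + 1 else + 0

nm : ℤ → ℤ
nm D = if isOne4 D then ((+ 1 - D) /ℕ 4) else - D

-- Elements of O_K written in the integral basis {1, ω}:  (x , y) ↦ x + y ω.
O : Set
O = ℤ × ℤ

zeroO : O
zeroO = (+ 0 , + 0)

oneO : O
oneO = (+ 1 , + 0)

addO : O → O → O
addO (a , b) (c , d) = (a + c , b + d)

mulO : ℤ → O → O → O
mulO D (a , b) (c , d) = (a * c - nm D * (b * d) , a * d + b * c + tr D * (b * d))

powO : ℤ → O → ℕ → O
powO D z ℕ.zero = oneO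
powO D z (ℕ.suc k) = mulO D z (powO D z k)

-- Galois conjugation: ω̄ = tr − ω
conjO : ℤ → O → O
conjO D (a , b) = (a + tr D * b , - b)

normO : ℤ → O → ℤ
normO D (x , y) = x * x + tr D * (x * y) + nm D * (y * y)

Q₀ : ℤ → ℤ → ℤ → ℤ
Q₀ D x y = x * x + tr D * (x * y) + nm D * (y * y)

Subset : Set₁
Subset = O → Set

IsIdeal : ℤ → Subset → Set
IsIdeal D I = I zeroO
            × (∀ x y → I x → I y → I (addO x y))
            × (∀ r x → I x → I (mulO D r x))

NonZeroIdeal : Subset → Set
NonZeroIdeal I = ∃[ z ] (I z × z ≢ zeroO)

_≐_ : Subset → Subset → Set
I ≐ J = ∀ z → (I z → J z) × (J z → I z)

gen2 : ℤ → O → O → Subset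
gen2 D a b z = ∃[ r ] ∃[ s ] (z ≡ addO (mulO D r a) (mulO D s b))

gen1 : ℤ → O → Subset
gen1 D g z = ∃[ r ] (z ≡ mulO D g r)

IsPrincipal : ℤ → Subset → Set
IsPrincipal D I = ∃[ g ] (I ≐ gen1 D g)

wholeO : Subset
wholeO z = z ≡ z

sumO : List O → O
sumO = foldr addO zeroO

mulI : ℤ → Subset → Subset → Subset
mulI D I J z = ∃[ ps ] (All (λ q → I (Data.Product.proj₁ q) × J (Data.Product.proj₂ q)) ps
                        × z ≡ sumO (Data.List.map (λ q → mulO D (Data.Product.proj₁ q) (Data.Product.proj₂ q)) ps))

powI : ℤ → Subset → ℕ → Subset
powI D I ℕ.zero = wholeO
powI D I (ℕ.suc k) = mulI D I (powI D I k)

conjI : ℤ → Subset → Subset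
conjI D I z = I (conjO D z)

scaleI : ℤ → O → Subset → Subset
scaleI D α I z = ∃[ i ] (I i × z ≡ mulO D α i)

_~[_]_ : Subset → ℤ → Subset → Set
I ~[ D ] J = ∃[ α ] ∃[ β ] (α ≢ zeroO × β ≢ zeroO × (scaleI D α I ≐ scaleI D β J))

IsClassNumber : ℤ → ℕ → Set₁
IsClassNumber D h =
  Σ (Fin h → Subset) λ rep →
      (∀ i → IsIdeal D (rep i) × NonZeroIdeal (rep i))
    × (∀ i j → rep i ~[ D ] rep j → i ≡ j)
    × (∀ I → IsIdeal D I → NonZeroIdeal I → ∃[ i ] (I ~[ D ] rep i))

form : ℤ → ℤ → ℤ → ℤ → ℤ → ℤ
form a b c x y = a * (x * x) + b * (x * y) + c * (y * y)

-- Reduced forms; conditions involving √Δ written with squares: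
--  b < √Δ  ⟺ b² < Δ (b > 0);  √Δ − b < 2|a| ⟺ Δ < (2|a|+b)²;
--  2|a| < √Δ + b ⟺ 2|a| − b ≤ 0 or (2|a|−b)² < Δ.
Reduced : ℤ → ℤ → ℤ → ℤ → Set
Reduced Δ a b c =
  (Δ < + 0 × (+ ∣ b ∣ ≤ a) × (a ≤ c))
  ⊎ (+ 0 < Δ × + 0 < b × b * b < Δ
     × Δ < (+ 2 * + ∣ a ∣ + b) * (+ 2 * + ∣ a ∣ + b)
     × ((+ 2 * + ∣ a ∣ - b ≤ + 0) ⊎ ((+ 2 * + ∣ a ∣ - b) * (+ 2 * + ∣ a ∣ - b) < Δ)))

module Submission where

-- Put α = a x₀ + (β + ω) y₀.  Since α lies in
-- I_a = ⟨a , β + ω⟩, its power α^ℓ lies in I_a^ℓ = (π), so α^ℓ = π γ for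
-- some γ = u + v ω ∈ O_K.  Multiplying by π̄ and using π̄ π = N(π) = a^ℓ
-- gives the system  a^ℓ (u + v ω) = π̄ α^ℓ,  i.e. a₁(x₀,y₀) = u and
-- a₂(x₀,y₀) = v.  Taking norms of α^ℓ = π γ gives
-- a^ℓ Q₀(u,v) = N(α)^ℓ = (a p)^ℓ, because N(α) = a Q_i(x₀,y₀) = a p;
-- cancelling a^ℓ ≠ 0 yields p^ℓ = Q₀(u,v).

open import Defs
open import Data.Nat as ℕ using (ℕ)
open import Data.Nat.Divisibility using () renaming (_∣_ to _∣ℕ_)
open import Data.Nat.Primality using (Prime)
open import Data.Integer
open import Data.Product using (∃-syntax; _×_; _,_; proj₁; proj₂)
open import Relation.Binary.PropositionalEquality using (_≡_; _≢_; refl; sym; cong; cong₂; module ≡-Reasoning)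
open import Data.Integer.Properties using (*-cancelˡ-≡; i^n≡0⇒i≡0; +-identityʳ)
open import Data.Integer.Tactic.RingSolver using (solve-∀)
open import Data.List using (_∷_; [])
open import Data.List.Relation.Unary.All using (_∷_; [])

open ≡-Reasoning

^-distribʳ-* : ∀ (a b : ℤ) ℓ → (a * b) ^ ℓ ≡ a ^ ℓ * b ^ ℓ
^-distribʳ-* a b ℕ.zero = refl
^-distribʳ-* a b (ℕ.suc ℓ) = begin
  (a * b) * (a * b) ^ ℓ     ≡⟨ cong ((a * b) *_) (^-distribʳ-* a b ℓ) ⟩
  (a * b) * (a ^ ℓ * b ^ ℓ) ≡⟨ interchange a b (a ^ ℓ) (b ^ ℓ) ⟩
  (a * a ^ ℓ) * (b * b ^ ℓ) ∎
  where
  interchange : ∀ (a b c d : ℤ) → (a * b) * (c * d) ≡ (a * c) * (b * d)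
  interchange = solve-∀

cancel-nonzero : ∀ (k x y : ℤ) → k ≢ + 0 → k * x ≡ k * y → x ≡ y
cancel-nonzero k x y k≢0 = *-cancelˡ-≡ k x y {{≢-nonZero k≢0}}

normO-mul : ∀ D x y → normO D (mulO D x y) ≡ normO D x * normO D y
normO-mul D (a , b) (c , d) = identity (tr D) (nm D) a b c d
  where
  identity : ∀ (t n a b c d : ℤ) →
    (a * c - n * (b * d)) * (a * c - n * (b * d))
     + t * ((a * c - n * (b * d)) * (a * d + b * c + t * (b * d)))
     + n * ((a * d + b * c + t * (b * d)) * (a * d + b * c + t * (b * d)))
    ≡ (a * a + t * (a * b) + n * (b * b)) * (c * c + t * (c * d) + n * (d * d))
  identity = solve-∀

normO-pow : ∀ D α ℓ → normO D (powO D α ℓ) ≡ normO D α ^ ℓ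
normO-pow D α ℕ.zero = normOne (tr D) (nm D)
  where
  normOne : ∀ (t n : ℤ) → + 1 * + 1 + t * (+ 1 * + 0) + n * (+ 0 * + 0) ≡ + 1
  normOne = solve-∀
normO-pow D α (ℕ.suc ℓ) = begin
  normO D (mulO D α (powO D α ℓ))    ≡⟨ normO-mul D α (powO D α ℓ) ⟩
  normO D α * normO D (powO D α ℓ)   ≡⟨ cong (normO D α *_) (normO-pow D α ℓ) ⟩
  normO D α * normO D α ^ ℓ          ∎

norm-conj-mul : ∀ D π γ → mulO D (normO D π , + 0) γ ≡ mulO D (conjO D π) (mulO D π γ)
norm-conj-mul D (p₁ , p₂) (g₁ , g₂) =
  cong₂ _,_ (first (tr D) (nm D) p₁ p₂ g₁ g₂) (second (tr D) (nm D) p₁ p₂ g₁ g₂)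
  where
  first : ∀ (t n p₁ p₂ g₁ g₂ : ℤ) →
    (p₁ * p₁ + t * (p₁ * p₂) + n * (p₂ * p₂)) * g₁ - n * (+ 0 * g₂)
    ≡ (p₁ + t * p₂) * (p₁ * g₁ - n * (p₂ * g₂))
      - n * ((- p₂) * (p₁ * g₂ + p₂ * g₁ + t * (p₂ * g₂)))
  first = solve-∀
  second : ∀ (t n p₁ p₂ g₁ g₂ : ℤ) →
    (p₁ * p₁ + t * (p₁ * p₂) + n * (p₂ * p₂)) * g₂ + + 0 * g₁ + t * (+ 0 * g₂)
    ≡ (p₁ + t * p₂) * (p₁ * g₂ + p₂ * g₁ + t * (p₂ * g₂))
      + (- p₂) * (p₁ * g₁ - n * (p₂ * g₂))
      + t * ((- p₂) * (p₁ * g₂ + p₂ * g₁ + t * (p₂ * g₂)))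
  second = solve-∀

norm-linear : ∀ D (a β c : ℤ) → a * c ≡ normO D (β , + 1) →
  ∀ x y → normO D (a * x + β * y , y) ≡ a * form a (+ 2 * β + tr D) c x y
norm-linear D a β c ac x y = begin
  normO D (a * x + β * y , y)
    ≡⟨ expand (tr D) (nm D) a β x y ⟩
  a * (a * (x * x) + (+ 2 * β + tr D) * (x * y)) + normO D (β , + 1) * (y * y)
    ≡⟨ cong (λ z → a * (a * (x * x) + (+ 2 * β + tr D) * (x * y)) + z * (y * y)) (sym ac) ⟩
  a * (a * (x * x) + (+ 2 * β + tr D) * (x * y)) + (a * c) * (y * y)
    ≡⟨ collect (tr D) a β c x y ⟩
  a * form a (+ 2 * β + tr D) c x y ∎
  where
  expand : ∀ (t n a β x y : ℤ) →
    (a * x + β * y) * (a * x + β * y) + t * ((a * x + β * y) * y) + n * (y * y)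
    ≡ a * (a * (x * x) + (+ 2 * β + t) * (x * y))
      + (β * β + t * (β * + 1) + n * (+ 1 * + 1)) * (y * y)
  expand = solve-∀
  collect : ∀ (t a β c x y : ℤ) →
    a * (a * (x * x) + (+ 2 * β + t) * (x * y)) + (a * c) * (y * y)
    ≡ a * (a * (x * x) + (+ 2 * β + t) * (x * y) + c * (y * y))
  collect = solve-∀

linear-mem : ∀ D (a β x y : ℤ) → gen2 D (a , + 0) (β , + 1) (a * x + β * y , y)
linear-mem D a β x y =
  (x , + 0) , (y , + 0) , cong₂ _,_ (first (nm D) a β x y) (second (tr D) a β x y)
  where
  first : ∀ (n a β x y : ℤ) →
    a * x + β * y ≡ (x * a - n * (+ 0 * + 0)) + (y * β - n * (+ 0 * + 1))
  first = solve-∀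
  second : ∀ (t a β x y : ℤ) →
    y ≡ (x * + 0 + + 0 * a + t * (+ 0 * + 0)) + (y * + 1 + + 0 * β + t * (+ 0 * + 1))
  second = solve-∀

-- If α ∈ I then α^ℓ ∈ I^ℓ: α^(ℓ+1) = α·α^ℓ is a one-term sum of products.
pow-mem : ∀ D (I : Subset) α → I α → ∀ ℓ → powI D I ℓ (powO D α ℓ)
pow-mem D I α α∈I ℕ.zero = refl
pow-mem D I α α∈I (ℕ.suc ℓ) =
  ((α , powO D α ℓ) ∷ []) , ((α∈I , pow-mem D I α α∈I ℓ) ∷ []) , sym (addO-zeroʳ _)
  where
  addO-zeroʳ : ∀ z → addO z zeroO ≡ z
  addO-zeroʳ (u , v) = cong₂ _,_ (+-identityʳ u) (+-identityʳ v)

theorem4 : (D : ℤ) → SquareFree D → D ≢ + 1 →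
    (h : ℕ) → IsClassNumber D h →
    (a β c : ℤ) → a ≢ + 0 → a * c ≡ normO D (β , + 1) →
    Reduced (Disc D) a (+ 2 * β + tr D) c →
    (p : ℕ) → Prime p → p ≢ 2 →
    (P : Subset) → IsIdeal D P → mulI D P (conjI D P) ≐ gen1 D (+ p , + 0) →
    (ℓ : ℕ) → ℓ ∣ℕ h → IsPrincipal D (powI D P ℓ) →
    (∀ m → m ∣ℕ h → IsPrincipal D (powI D P m) → ℓ ℕ.≤ m) →
    (π : O) → powI D (gen2 D (a , + 0) (β , + 1)) ℓ ≐ gen1 D π →
    normO D π ≡ a ^ ℓ →
    (x₀ y₀ : ℤ) → form a (+ 2 * β + tr D) c x₀ y₀ ≡ + p →
    ∃[ u ] ∃[ v ] ((Q₀ D u v ≡ (+ p) ^ ℓ)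
    × (mulO D (a ^ ℓ , + 0) (u , v)
    ≡ mulO D (conjO D π) (powO D (a * x₀ + β * y₀ , y₀) ℓ)))
theorem4 D _ _ _ _ a β c a≢0 ac _ p _ _ _ _ _ ℓ _ _ _ π Iᵃˡ≐⟨π⟩ Nπ x₀ y₀ Qp =
  proj₁ γ , proj₂ γ , normEquation , system
  where
  α : O
  α = (a * x₀ + β * y₀ , y₀)

  b : ℤ
  b = + 2 * β + tr D

  factorisation : ∃[ γ ] (powO D α ℓ ≡ mulO D π γ)
  factorisation = proj₁ (Iᵃˡ≐⟨π⟩ (powO D α ℓ))
    (pow-mem D (gen2 D (a , + 0) (β , + 1)) α (linear-mem D a β x₀ y₀) ℓ)

  γ : O
  γ = proj₁ factorisation

  αˡ≡πγ : powO D α ℓ ≡ mulO D π γ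
  αˡ≡πγ = proj₂ factorisation

  system : mulO D (a ^ ℓ , + 0) γ ≡ mulO D (conjO D π) (powO D α ℓ)
  system = begin
    mulO D (a ^ ℓ , + 0) γ            ≡⟨ cong (λ z → mulO D (z , + 0) γ) (sym Nπ) ⟩
    mulO D (normO D π , + 0) γ        ≡⟨ norm-conj-mul D π γ ⟩
    mulO D (conjO D π) (mulO D π γ)   ≡⟨ cong (mulO D (conjO D π)) (sym αˡ≡πγ) ⟩
    mulO D (conjO D π) (powO D α ℓ)   ∎

  scaledNorm : a ^ ℓ * normO D γ ≡ a ^ ℓ * (+ p) ^ ℓ
  scaledNorm = begin
    a ^ ℓ * normO D γ             ≡⟨ cong (_* normO D γ) (sym Nπ) ⟩
    normO D π * normO D γ         ≡⟨ sym (normO-mul D π γ) ⟩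
    normO D (mulO D π γ)          ≡⟨ cong (normO D) (sym αˡ≡πγ) ⟩
    normO D (powO D α ℓ)          ≡⟨ normO-pow D α ℓ ⟩
    normO D α ^ ℓ                 ≡⟨ cong (_^ ℓ) (norm-linear D a β c ac x₀ y₀) ⟩
    (a * form a b c x₀ y₀) ^ ℓ    ≡⟨ cong (λ q → (a * q) ^ ℓ) Qp ⟩
    (a * + p) ^ ℓ                 ≡⟨ ^-distribʳ-* a (+ p) ℓ ⟩
    a ^ ℓ * (+ p) ^ ℓ             ∎

  normEquation : normO D γ ≡ (+ p) ^ ℓ
  normEquation = cancel-nonzero (a ^ ℓ) (normO D γ) ((+ p) ^ ℓ)
    (λ aˡ≡0 → a≢0 (i^n≡0⇒i≡0 a ℓ aˡ≡0)) scaledNorm
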